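{- Let $n > 0$ be an integer and write $n = 3p + q$ with integers $p \ge 0$ and $q \in \{0,1,2\}$. Then $$\sum_{i=0}^{p+ \lfloor (q - 1)/3 \rfloor} \frac{1}{n-3i} \binom{n-i-1}{2i} 2^i = \frac{1}{n} \left( 2^{n-1} + \mathbb{1}_{2 \mid n} (-1)^{n/2} - \mathbb{1}_{3 \mid n}\, 3 \cdot 2^{n/3 - 1} \right)$$ and $$\sum_{i=0}^{p+ \lfloor (q - 1)/3 \rfloor} \frac{1}{n-3i} \binom{n-i}{2i+1} 2^i = \frac{1}{n+3/2} \left( 2^{n} + \mathbb{1}_{2 \mid n} \tfrac{1}{2} (-1)^{n/2} + \mathbb{1}_{2 \mid (n-1)} \tfrac{1}{2} (-1)^{(n-1)/2} - \mathbb{1}_{3 \mid n}\, 3 \cdot 2^{n/3 - 1} \right).$$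
   Context: $\mathbb{1}_{P}$ equals $1$ if the condition $P$ holds and $0$ otherwise; binomial coefficients are ordinary ones. -}

module Defs where

open import Data.Nat as ℕ using (ℕ; zero; suc)
open import Data.Integer as ℤ using (ℤ; +_; -[1+_])
open import Data.Rational using (ℚ; 0ℚ; 1ℚ; _+_; _*_; _÷_; ≢-nonZero)
open import Data.Rational.Properties using (_≟_)
open import Relation.Nullary using (Dec; yes; no)

⟦_⟧ : ℕ → ℚ
⟦ k ⟧ = Data.Rational._/_ (+ k) 1

-- total division on ℚ (x / 0 := 0); only ever applied to nonzero denominators here
infixl 7 _÷′_
_÷′_ : ℚ → ℚ → ℚ
p ÷′ q with q ≟ 0ℚ
... | yes _ = 0ℚ
... | no q≢0 = _÷_ p q {{≢-nonZero q≢0}}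

pow : ℚ → ℕ → ℚ
pow x zero = 1ℚ
pow x (suc k) = x * pow x k

sumFirst : ℕ → (ℕ → ℚ) → ℚ
sumFirst zero f = 0ℚ
sumFirst (suc m) f = sumFirst m f + f m

-- ∑_{i=0}^{U} f i for an integer upper limit U (empty sum if U < 0)
sumUpTo : ℤ → (ℕ → ℚ) → ℚ
sumUpTo (+ m) f = sumFirst (suc m) f
sumUpTo -[1+ _ ] f = 0ℚ

𝟙 : ∀ {p} {P : Set p} → Dec P → ℚ
𝟙 (yes _) = 1ℚ
𝟙 (no _) = 0ℚ

{-# OPTIONS --safe #-}
module Submission where

-- Put D = n − 3i and N = n − 1. The absorption identity (k + 1)·C(k + D, k + 1) = D·C(k + D, k)
-- turns the i-th summand of the first sum into (C(N − i, 2i)·2^i + 3·C(N − i, 2i − 1)·2^(i−1))/n,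
-- and that of the second into (2·C(n − i, 2i + 1) + 3·C(n − i, 2i))·2^i/(2n + 3). Hence both sums are
-- combinations of the slant sums Φ_r(N) = Σ_j C(N − j, r + 2j)·2^j of Pascal's triangle, short of
-- the single term i = n/3 which the range omits because its denominator vanishes. Pascal's rule
-- gives Φ_{r+1}(N + 1) = Φ_r(N) + Φ_{r+1}(N) and Φ_0(N + 1) = 1 + 2·Φ_2(N); this linear recurrence
-- has eigenvalues 2 and ±i (and 1 from the constant term), so Φ_0, Φ_1, Φ_2 are combinations of
-- 2^N, cos(Nπ/2), sin(Nπ/2) and 1, and the parity indicators of the statement are these cosines
-- and sines.

open import Defs
open import Data.Nat as ℕ using (ℕ; zero; suc; _∸_; _<_; _≤_; z≤n; s≤s)
import Data.Nat.Properties as ℕP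
import Data.Nat.Coprimality as Coprimality
open import Data.Nat.Combinatorics using (_C_; nCk+nC[k+1]≡[n+1]C[k+1]; nC1≡n; nCn≡1; k>n⇒nCk≡0)
open import Data.Nat.Divisibility using (_∣_; _∣?_; divides-refl; m∣m*n; ∣-refl; ∣m+n∣m⇒∣n; ∣m∣n⇒∣m+n)
open import Data.Nat.DivMod using (m*n/n≡m; m/n≡1+[m∸n]/n)
import Data.Nat.Tactic.RingSolver as ℕ-Ring
open import Data.Integer as ℤ using (+_)
import Data.Integer.Properties as ℤP
open import Data.Integer.DivMod as ℤD using ()
open import Data.Rational using (ℚ; mkℚ; 0ℚ; 1ℚ; _+_; _-_; _*_; -_; ≢-nonZero)
import Data.Rational.Properties as ℚP
open import Data.List using (_∷_; [])
open import Data.Maybe using (Maybe; just; nothing)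
open import Data.Product using (_×_; _,_; proj₁; proj₂; ∃-syntax)
open import Level using (0ℓ)
open import Tactic.RingSolver using (solve)
open import Tactic.RingSolver.Core.AlmostCommutativeRing using (AlmostCommutativeRing; fromCommutativeRing)
open import Relation.Binary.PropositionalEquality
open import Relation.Nullary using (Dec; yes; no; ¬_; contradiction)
open ≡-Reasoning

ℚ-ring : AlmostCommutativeRing 0ℓ 0ℓ
ℚ-ring = fromCommutativeRing ℚP.+-*-commutativeRing 0≟_
  where
  0≟_ : (x : ℚ) → Maybe (0ℚ ≡ x)
  0≟ x with 0ℚ ℚP.≟ x
  ... | yes 0≡x = just 0≡x
  ... | no _ = nothing

⟦⟧≡mkℚ : ∀ k → ⟦ k ⟧ ≡ mkℚ (+ k) 0 (Coprimality.sym (Coprimality.1-coprimeTo k))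
⟦⟧≡mkℚ k = ℚP.normalize-coprime _

⟦⟧-homo-+ : ∀ a b → ⟦ a ℕ.+ b ⟧ ≡ ⟦ a ⟧ + ⟦ b ⟧
⟦⟧-homo-+ a b rewrite ⟦⟧≡mkℚ a | ⟦⟧≡mkℚ b =
  cong (λ z → Data.Rational._/_ z 1)
       (trans (sym (ℤP.pos-+ a b)) (sym (cong₂ ℤ._+_ (ℤP.*-identityʳ (+ a)) (ℤP.*-identityʳ (+ b)))))

⟦⟧-homo-* : ∀ a b → ⟦ a ℕ.* b ⟧ ≡ ⟦ a ⟧ * ⟦ b ⟧
⟦⟧-homo-* a b rewrite ⟦⟧≡mkℚ a | ⟦⟧≡mkℚ b = cong (λ z → Data.Rational._/_ z 1) (ℤP.pos-* a b)

⟦⟧-homo-^ : ∀ m i → pow ⟦ m ⟧ i ≡ ⟦ m ℕ.^ i ⟧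
⟦⟧-homo-^ m zero = refl
⟦⟧-homo-^ m (suc i) = trans (cong (⟦ m ⟧ *_) (⟦⟧-homo-^ m i)) (sym (⟦⟧-homo-* m (m ℕ.^ i)))

⟦⟧-homo-∸ : ∀ {m n} → n ≤ m → ⟦ m ∸ n ⟧ ≡ ⟦ m ⟧ - ⟦ n ⟧
⟦⟧-homo-∸ {m} {n} n≤m = begin
  ⟦ m ∸ n ⟧                   ≡⟨ x≡y+x-y ⟦ m ∸ n ⟧ ⟦ n ⟧ ⟩
  (⟦ n ⟧ + ⟦ m ∸ n ⟧) - ⟦ n ⟧  ≡⟨ cong (_- ⟦ n ⟧) (sym (⟦⟧-homo-+ n (m ∸ n))) ⟩
  ⟦ n ℕ.+ (m ∸ n) ⟧ - ⟦ n ⟧    ≡⟨ cong (λ k → ⟦ k ⟧ - ⟦ n ⟧) (ℕP.m+[n∸m]≡n n≤m) ⟩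
  ⟦ m ⟧ - ⟦ n ⟧                ∎
  where
  x≡y+x-y : ∀ x y → x ≡ (y + x) - y
  x≡y+x-y x y = solve (x ∷ y ∷ []) ℚ-ring

x+y≡z⇒x≡z-y : ∀ x y {z} → x + y ≡ z → x ≡ z - y
x+y≡z⇒x≡z-y x y refl = solve (x ∷ y ∷ []) ℚ-ring

⟦⟧≢0 : ∀ {k} → 0 < k → ⟦ k ⟧ ≢ 0ℚ
⟦⟧≢0 {suc k} _ eq with trans (sym (⟦⟧≡mkℚ (suc k))) eq
... | ()

÷′-inverseˡ : ∀ b → b ≢ 0ℚ → (1ℚ ÷′ b) * b ≡ 1ℚ
÷′-inverseˡ b b≢0 with b ℚP.≟ 0ℚ
... | yes b≡0 = contradiction b≡0 b≢0
... | no b≢0′ = trans (cong (_* b) (ℚP.*-identityˡ (Data.Rational.1/_ b {{≢-nonZero b≢0′}})))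
                      (ℚP.*-inverseˡ b {{≢-nonZero b≢0′}})

÷′-unique : ∀ a b → a * b ≡ 1ℚ → 1ℚ ÷′ a ≡ b
÷′-unique a b ab≡1 = begin
  1ℚ ÷′ a              ≡⟨ sym (ℚP.*-identityʳ (1ℚ ÷′ a)) ⟩
  (1ℚ ÷′ a) * 1ℚ       ≡⟨ cong ((1ℚ ÷′ a) *_) (sym ab≡1) ⟩
  (1ℚ ÷′ a) * (a * b)  ≡⟨ sym (ℚP.*-assoc (1ℚ ÷′ a) a b) ⟩
  (1ℚ ÷′ a) * a * b    ≡⟨ cong (_* b) (÷′-inverseˡ a a≢0) ⟩
  1ℚ * b               ≡⟨ ℚP.*-identityˡ b ⟩
  b                    ∎
  where
  a≢0 : a ≢ 0ℚ
  a≢0 a≡0 with trans (sym ab≡1) (trans (cong (_* b) a≡0) (ℚP.*-zeroˡ b))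
  ... | ()

÷′-cross : ∀ {a b x y} → a ≢ 0ℚ → b ≢ 0ℚ → a * x ≡ b * y → (1ℚ ÷′ b) * x ≡ (1ℚ ÷′ a) * y
÷′-cross {a} {b} a≢0 b≢0 = cross {1ℚ ÷′ a} {1ℚ ÷′ b} (÷′-inverseˡ a a≢0) (÷′-inverseˡ b b≢0)
  where
  cross : ∀ {a′ b′ x y} → a′ * a ≡ 1ℚ → b′ * b ≡ 1ℚ → a * x ≡ b * y → b′ * x ≡ a′ * y
  cross {a′} {b′} {x} {y} a′a≡1 b′b≡1 ax≡by = begin
    b′ * x                ≡⟨ solve (a′ ∷ b′ ∷ x ∷ []) ℚ-ring ⟩
    b′ * x * 1ℚ           ≡⟨ cong (b′ * x *_) (sym a′a≡1) ⟩
    b′ * x * (a′ * a)     ≡⟨ solve (a ∷ a′ ∷ b′ ∷ x ∷ []) ℚ-ring ⟩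
    a′ * b′ * (a * x)     ≡⟨ cong (a′ * b′ *_) ax≡by ⟩
    a′ * b′ * (b * y)     ≡⟨ solve (b ∷ a′ ∷ b′ ∷ y ∷ []) ℚ-ring ⟩
    a′ * y * (b′ * b)     ≡⟨ cong (a′ * y *_) b′b≡1 ⟩
    a′ * y * 1ℚ           ≡⟨ solve (a′ ∷ y ∷ []) ℚ-ring ⟩
    a′ * y                ∎

sumFirst-cong : ∀ L {f g : ℕ → ℚ} → (∀ j → j < L → f j ≡ g j) → sumFirst L f ≡ sumFirst L g
sumFirst-cong zero f≗g = refl
sumFirst-cong (suc L) f≗g =
  cong₂ _+_ (sumFirst-cong L (λ j j<L → f≗g j (ℕP.m<n⇒m<1+n j<L))) (f≗g L (ℕP.n<1+n L))

sumFirst-+ : ∀ L (f g : ℕ → ℚ) → sumFirst L (λ j → f j + g j) ≡ sumFirst L f + sumFirst L g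
sumFirst-+ zero f g = refl
sumFirst-+ (suc L) f g =
  trans (cong (_+ (f L + g L)) (sumFirst-+ L f g)) (interchange (sumFirst L f) (sumFirst L g) (f L) (g L))
  where
  interchange : ∀ a b c d → a + b + (c + d) ≡ a + c + (b + d)
  interchange a b c d = solve (a ∷ b ∷ c ∷ d ∷ []) ℚ-ring

sumFirst-*ˡ : ∀ L c (f : ℕ → ℚ) → sumFirst L (λ j → c * f j) ≡ c * sumFirst L f
sumFirst-*ˡ zero c f = sym (ℚP.*-zeroʳ c)
sumFirst-*ˡ (suc L) c f =
  trans (cong (_+ c * f L) (sumFirst-*ˡ L c f)) (sym (ℚP.*-distribˡ-+ c (sumFirst L f) (f L)))

sumFirst-suc : ∀ L (f : ℕ → ℚ) → sumFirst (suc L) f ≡ f 0 + sumFirst L (λ j → f (suc j))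
sumFirst-suc zero f = trans (ℚP.+-identityˡ (f 0)) (sym (ℚP.+-identityʳ (f 0)))
sumFirst-suc (suc L) f = trans (cong (_+ f (suc L)) (sumFirst-suc L f)) (ℚP.+-assoc (f 0) _ _)

sumFirst-extend : ∀ L {f : ℕ → ℚ} → (∀ j → L ≤ j → f j ≡ 0ℚ) → ∀ k → sumFirst (k ℕ.+ L) f ≡ sumFirst L f
sumFirst-extend L f≡0 zero = refl
sumFirst-extend L {f} f≡0 (suc k) = begin
  sumFirst (k ℕ.+ L) f + f (k ℕ.+ L)  ≡⟨ cong (λ x → sumFirst (k ℕ.+ L) f + x) (f≡0 (k ℕ.+ L) (ℕP.m≤n+m L k)) ⟩
  sumFirst (k ℕ.+ L) f + 0ℚ           ≡⟨ ℚP.+-identityʳ _ ⟩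
  sumFirst (k ℕ.+ L) f                ≡⟨ sumFirst-extend L f≡0 k ⟩
  sumFirst L f                        ∎

sumFirst-support : ∀ L M {f : ℕ → ℚ} → (∀ j → L ≤ j → f j ≡ 0ℚ) → (∀ j → M ≤ j → f j ≡ 0ℚ) →
                   sumFirst L f ≡ sumFirst M f
sumFirst-support L M {f} f≡0≥L f≡0≥M = begin
  sumFirst L f          ≡⟨ sym (sumFirst-extend L f≡0≥L M) ⟩
  sumFirst (M ℕ.+ L) f  ≡⟨ cong (λ k → sumFirst k f) (ℕP.+-comm M L) ⟩
  sumFirst (L ℕ.+ M) f  ≡⟨ sumFirst-extend M f≡0≥M L ⟩
  sumFirst M f          ∎

[1+k]*[1+n]C[1+k]≡[1+n]*nCk : ∀ n k → suc k ℕ.* (suc n C suc k) ≡ suc n ℕ.* (n C k)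
[1+k]*[1+n]C[1+k]≡[1+n]*nCk n zero =
  trans (ℕP.*-identityˡ (suc n C 1)) (trans (nC1≡n (suc n)) (sym (ℕP.*-identityʳ (suc n))))
[1+k]*[1+n]C[1+k]≡[1+n]*nCk zero (suc k) rewrite k>n⇒nCk≡0 {1} {2 ℕ.+ k} (s≤s (s≤s z≤n)) =
  ℕP.*-zeroʳ (2 ℕ.+ k)
[1+k]*[1+n]C[1+k]≡[1+n]*nCk (suc n) (suc k) = begin
  suc (suc k) ℕ.* (suc (suc n) C suc (suc k))   ≡⟨ cong (suc (suc k) ℕ.*_) (sym (nCk+nC[k+1]≡[n+1]C[k+1] (suc n) (suc k))) ⟩
  suc (suc k) ℕ.* (x ℕ.+ y)                     ≡⟨ ℕP.*-distribˡ-+ (suc (suc k)) x y ⟩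
  (x ℕ.+ suc k ℕ.* x) ℕ.+ suc (suc k) ℕ.* y      ≡⟨ cong₂ (λ u v → (x ℕ.+ u) ℕ.+ v) ([1+k]*[1+n]C[1+k]≡[1+n]*nCk n k)
                                                                                ([1+k]*[1+n]C[1+k]≡[1+n]*nCk n (suc k)) ⟩
  (x ℕ.+ suc n ℕ.* a) ℕ.+ suc n ℕ.* b            ≡⟨ ℕP.+-assoc x _ _ ⟩
  x ℕ.+ (suc n ℕ.* a ℕ.+ suc n ℕ.* b)            ≡⟨ cong (x ℕ.+_) (sym (ℕP.*-distribˡ-+ (suc n) a b)) ⟩
  x ℕ.+ suc n ℕ.* (a ℕ.+ b)                      ≡⟨ cong (λ u → x ℕ.+ suc n ℕ.* u) (nCk+nC[k+1]≡[n+1]C[k+1] n k) ⟩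
  x ℕ.+ suc n ℕ.* x                              ∎
  where
  a = n C k
  b = n C suc k
  x = suc n C suc k
  y = suc n C suc (suc k)

[1+k]*[k+d]C[1+k]≡d*[k+d]Ck : ∀ k d → suc k ℕ.* ((k ℕ.+ d) C suc k) ≡ d ℕ.* ((k ℕ.+ d) C k)
[1+k]*[k+d]C[1+k]≡d*[k+d]Ck k d = ℕP.+-cancelʳ-≡ (suc k ℕ.* x) _ _ (begin
  suc k ℕ.* y ℕ.+ suc k ℕ.* x   ≡⟨ ℕP.+-comm (suc k ℕ.* y) _ ⟩
  suc k ℕ.* x ℕ.+ suc k ℕ.* y   ≡⟨ sym (ℕP.*-distribˡ-+ (suc k) x y) ⟩
  suc k ℕ.* (x ℕ.+ y)           ≡⟨ cong (suc k ℕ.*_) (nCk+nC[k+1]≡[n+1]C[k+1] (k ℕ.+ d) k) ⟩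
  suc k ℕ.* (suc (k ℕ.+ d) C suc k) ≡⟨ [1+k]*[1+n]C[1+k]≡[1+n]*nCk (k ℕ.+ d) k ⟩
  suc (k ℕ.+ d) ℕ.* x           ≡⟨ ℕP.*-distribʳ-+ x (suc k) d ⟩
  suc k ℕ.* x ℕ.+ d ℕ.* x       ≡⟨ ℕP.+-comm (suc k ℕ.* x) _ ⟩
  d ℕ.* x ℕ.+ suc k ℕ.* x       ∎)
  where
  x = (k ℕ.+ d) C k
  y = (k ℕ.+ d) C suc k

[1+n∸j]C[1+k]≡[n∸j]Ck+[n∸j]C[1+k] : ∀ n j k → j ≤ k → (suc n ∸ j) C suc k ≡ (n ∸ j) C k ℕ.+ (n ∸ j) C suc k
[1+n∸j]C[1+k]≡[n∸j]Ck+[n∸j]C[1+k] n zero k _ = sym (nCk+nC[k+1]≡[n+1]C[k+1] n k)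
[1+n∸j]C[1+k]≡[n∸j]Ck+[n∸j]C[1+k] zero (suc j) (suc k) _ rewrite ℕP.0∸n≡0 j = refl
[1+n∸j]C[1+k]≡[n∸j]Ck+[n∸j]C[1+k] (suc n) (suc j) k j<k =
  [1+n∸j]C[1+k]≡[n∸j]Ck+[n∸j]C[1+k] n j k (ℕP.<⇒≤ j<k)

slantTerm : ℕ → ℕ → ℕ → ℕ
slantTerm r N j = ((N ∸ j) C (r ℕ.+ 2 ℕ.* j)) ℕ.* 2 ℕ.^ j

slantTerm-pascal : ∀ r N j → slantTerm (suc r) (suc N) j ≡ slantTerm r N j ℕ.+ slantTerm (suc r) N j
slantTerm-pascal r N j =
  trans (cong (ℕ._* 2 ℕ.^ j) ([1+n∸j]C[1+k]≡[n∸j]Ck+[n∸j]C[1+k] N j (r ℕ.+ 2 ℕ.* j) j≤r+2j))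
        (ℕP.*-distribʳ-+ (2 ℕ.^ j) ((N ∸ j) C (r ℕ.+ 2 ℕ.* j)) ((N ∸ j) C suc (r ℕ.+ 2 ℕ.* j)))
  where
  j≤r+2j : j ≤ r ℕ.+ 2 ℕ.* j
  j≤r+2j = ℕP.≤-trans (ℕP.m≤m+n j (j ℕ.+ 0)) (ℕP.m≤n+m (2 ℕ.* j) r)

slantTerm-suc : ∀ r N j → slantTerm r N (suc j) ≡ 2 ℕ.* slantTerm (2 ℕ.+ r) (N ∸ 1) j
slantTerm-suc r N j
  rewrite ℕP.∸-+-assoc N 1 j | ℕP.*-suc 2 j | ℕP.+-suc r (suc (2 ℕ.* j)) | ℕP.+-suc r (2 ℕ.* j) =
  x*[2*y]≡2*[x*y] ((N ∸ suc j) C (2 ℕ.+ (r ℕ.+ 2 ℕ.* j))) (2 ℕ.^ j)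
  where
  x*[2*y]≡2*[x*y] : ∀ x y → x ℕ.* (2 ℕ.* y) ≡ 2 ℕ.* (x ℕ.* y)
  x*[2*y]≡2*[x*y] = ℕ-Ring.solve-∀

r+3j≡j+[r+2j] : ∀ r j → r ℕ.+ 3 ℕ.* j ≡ j ℕ.+ (r ℕ.+ 2 ℕ.* j)
r+3j≡j+[r+2j] = ℕ-Ring.solve-∀

slantTerm-vanishes : ∀ r {N} j → N < r ℕ.+ 3 ℕ.* j → slantTerm r N j ≡ 0
slantTerm-vanishes r {N} j N<r+3j =
  cong (ℕ._* 2 ℕ.^ j) (k>n⇒nCk≡0 (ℕP.m<n+o⇒m∸n<o N j {{r+2j≢0 r j N<r+3j}}
                                   (subst (N <_) (r+3j≡j+[r+2j] r j) N<r+3j)))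
  where
  r+2j≢0 : ∀ r j → N < r ℕ.+ 3 ℕ.* j → ℕ.NonZero (r ℕ.+ 2 ℕ.* j)
  r+2j≢0 zero zero ()
  r+2j≢0 zero (suc j) _ = _
  r+2j≢0 (suc r) j _ = _

slantTerm-diagonal : ∀ r j → slantTerm r (r ℕ.+ 3 ℕ.* j) j ≡ 2 ℕ.^ j
slantTerm-diagonal r j rewrite r+3j≡j+[r+2j] r j | ℕP.m+n∸m≡n j (r ℕ.+ 2 ℕ.* j) | nCn≡1 (r ℕ.+ 2 ℕ.* j) =
  ℕP.*-identityˡ (2 ℕ.^ j)

slantSum : ℕ → ℕ → ℚ
slantSum r N = sumFirst (suc N) (λ j → ⟦ slantTerm r N j ⟧)

<⇒<r+3* : ∀ r {N L} → N < L → N < r ℕ.+ 3 ℕ.* L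
<⇒<r+3* r {N} {L} N<L = ℕP.<-≤-trans N<L (ℕP.≤-trans (ℕP.m≤m+n L (2 ℕ.* L)) (ℕP.m≤n+m (3 ℕ.* L) r))

slantSum-truncate : ∀ r {N} L → N < r ℕ.+ 3 ℕ.* L → sumFirst L (λ j → ⟦ slantTerm r N j ⟧) ≡ slantSum r N
slantSum-truncate r {N} L N<r+3L =
  sumFirst-support L (suc N) (vanishes-from N<r+3L) (vanishes-from (<⇒<r+3* r (ℕP.n<1+n N)))
  where
  vanishes-from : ∀ {M} → N < r ℕ.+ 3 ℕ.* M → ∀ j → M ≤ j → ⟦ slantTerm r N j ⟧ ≡ 0ℚ
  vanishes-from N<r+3M j M≤j =
    cong ⟦_⟧ (slantTerm-vanishes r j (ℕP.<-≤-trans N<r+3M (ℕP.+-monoʳ-≤ r (ℕP.*-monoʳ-≤ 3 M≤j))))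

slantSum-pascal : ∀ r N → slantSum (suc r) (suc N) ≡ slantSum r N + slantSum (suc r) N
slantSum-pascal r N = begin
  slantSum (suc r) (suc N)
    ≡⟨ sumFirst-cong (2 ℕ.+ N) (λ j _ → trans (cong ⟦_⟧ (slantTerm-pascal r N j))
                                              (⟦⟧-homo-+ (slantTerm r N j) (slantTerm (suc r) N j))) ⟩
  sumFirst (2 ℕ.+ N) (λ j → ⟦ slantTerm r N j ⟧ + ⟦ slantTerm (suc r) N j ⟧)
    ≡⟨ sumFirst-+ (2 ℕ.+ N) (λ j → ⟦ slantTerm r N j ⟧) (λ j → ⟦ slantTerm (suc r) N j ⟧) ⟩
  sumFirst (2 ℕ.+ N) (λ j → ⟦ slantTerm r N j ⟧) + sumFirst (2 ℕ.+ N) (λ j → ⟦ slantTerm (suc r) N j ⟧)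
    ≡⟨ cong₂ _+_ (slantSum-truncate r (2 ℕ.+ N) (N<r+3[2+N] r))
                 (slantSum-truncate (suc r) (2 ℕ.+ N) (N<r+3[2+N] (suc r))) ⟩
  slantSum r N + slantSum (suc r) N ∎
  where
  N<r+3[2+N] : ∀ r → N < r ℕ.+ 3 ℕ.* (2 ℕ.+ N)
  N<r+3[2+N] r = <⇒<r+3* r (ℕP.m<n⇒m<1+n (ℕP.n<1+n N))

slantSum-zero-suc : ∀ N → slantSum 0 (suc N) ≡ 1ℚ + ⟦ 2 ⟧ * slantSum 2 N
slantSum-zero-suc N = begin
  slantSum 0 (suc N)
    ≡⟨ sumFirst-suc (suc N) _ ⟩
  1ℚ + sumFirst (suc N) (λ j → ⟦ slantTerm 0 (suc N) (suc j) ⟧)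
    ≡⟨ cong (λ s → 1ℚ + s) (sumFirst-cong (suc N) (λ j _ → trans (cong ⟦_⟧ (slantTerm-suc 0 (suc N) j))
                                                          (⟦⟧-homo-* 2 (slantTerm 2 N j)))) ⟩
  1ℚ + sumFirst (suc N) (λ j → ⟦ 2 ⟧ * ⟦ slantTerm 2 N j ⟧)
    ≡⟨ cong (λ s → 1ℚ + s) (sumFirst-*ˡ (suc N) ⟦ 2 ⟧ _) ⟩
  1ℚ + ⟦ 2 ⟧ * slantSum 2 N ∎

mutual
  cosQuarterTurns : ℕ → ℚ
  cosQuarterTurns zero = 1ℚ
  cosQuarterTurns (suc n) = - sinQuarterTurns n

  sinQuarterTurns : ℕ → ℚ
  sinQuarterTurns zero = 0ℚ
  sinQuarterTurns (suc n) = cosQuarterTurns n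

slantSum-closed-forms-step : ∀ P Q R p c s →
    ⟦ 5 ⟧ * P ≡ ⟦ 2 ⟧ * p + ⟦ 3 ⟧ * c + s →
    ⟦ 5 ⟧ * Q ≡ ⟦ 2 ⟧ * p - ⟦ 2 ⟧ * c + s →
    ⟦ 10 ⟧ * R ≡ ⟦ 4 ⟧ * p + c - ⟦ 3 ⟧ * s - ⟦ 5 ⟧ →
      ⟦ 5 ⟧ * (1ℚ + ⟦ 2 ⟧ * R) ≡ ⟦ 2 ⟧ * (⟦ 2 ⟧ * p) + ⟦ 3 ⟧ * (- s) + c
    × ⟦ 5 ⟧ * (P + Q) ≡ ⟦ 2 ⟧ * (⟦ 2 ⟧ * p) - ⟦ 2 ⟧ * (- s) + c
    × ⟦ 10 ⟧ * (Q + R) ≡ ⟦ 4 ⟧ * (⟦ 2 ⟧ * p) + - s - ⟦ 3 ⟧ * c - ⟦ 5 ⟧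
slantSum-closed-forms-step P Q R p c s hP hQ hR =
    (begin
      ⟦ 5 ⟧ * (1ℚ + ⟦ 2 ⟧ * R)                         ≡⟨ solve (R ∷ []) ℚ-ring ⟩
      ⟦ 5 ⟧ + ⟦ 10 ⟧ * R                               ≡⟨ cong (λ x → ⟦ 5 ⟧ + x) hR ⟩
      ⟦ 5 ⟧ + (⟦ 4 ⟧ * p + c - ⟦ 3 ⟧ * s - ⟦ 5 ⟧)      ≡⟨ solve (p ∷ c ∷ s ∷ []) ℚ-ring ⟩
      ⟦ 2 ⟧ * (⟦ 2 ⟧ * p) + ⟦ 3 ⟧ * (- s) + c          ∎) ,
    (begin
      ⟦ 5 ⟧ * (P + Q)                                  ≡⟨ solve (P ∷ Q ∷ []) ℚ-ring ⟩
      ⟦ 5 ⟧ * P + ⟦ 5 ⟧ * Q                            ≡⟨ cong₂ _+_ hP hQ ⟩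
      (⟦ 2 ⟧ * p + ⟦ 3 ⟧ * c + s) + (⟦ 2 ⟧ * p - ⟦ 2 ⟧ * c + s)
                                                       ≡⟨ solve (p ∷ c ∷ s ∷ []) ℚ-ring ⟩
      ⟦ 2 ⟧ * (⟦ 2 ⟧ * p) - ⟦ 2 ⟧ * (- s) + c          ∎) ,
    (begin
      ⟦ 10 ⟧ * (Q + R)                                 ≡⟨ solve (Q ∷ R ∷ []) ℚ-ring ⟩
      ⟦ 2 ⟧ * (⟦ 5 ⟧ * Q) + ⟦ 10 ⟧ * R                 ≡⟨ cong₂ (λ x y → ⟦ 2 ⟧ * x + y) hQ hR ⟩
      ⟦ 2 ⟧ * (⟦ 2 ⟧ * p - ⟦ 2 ⟧ * c + s) + (⟦ 4 ⟧ * p + c - ⟦ 3 ⟧ * s - ⟦ 5 ⟧)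
                                                       ≡⟨ solve (p ∷ c ∷ s ∷ []) ℚ-ring ⟩
      ⟦ 4 ⟧ * (⟦ 2 ⟧ * p) + - s - ⟦ 3 ⟧ * c - ⟦ 5 ⟧    ∎)

slantSum-closed-forms : ∀ N →
    ⟦ 5 ⟧ * slantSum 0 N ≡ ⟦ 2 ⟧ * pow ⟦ 2 ⟧ N + ⟦ 3 ⟧ * cosQuarterTurns N + sinQuarterTurns N
  × ⟦ 5 ⟧ * slantSum 1 N ≡ ⟦ 2 ⟧ * pow ⟦ 2 ⟧ N - ⟦ 2 ⟧ * cosQuarterTurns N + sinQuarterTurns N
  × ⟦ 10 ⟧ * slantSum 2 N ≡ ⟦ 4 ⟧ * pow ⟦ 2 ⟧ N + cosQuarterTurns N - ⟦ 3 ⟧ * sinQuarterTurns N - ⟦ 5 ⟧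
slantSum-closed-forms zero = refl , refl , refl
slantSum-closed-forms (suc N) =
  trans (cong (⟦ 5 ⟧ *_) (slantSum-zero-suc N)) (proj₁ step) ,
  trans (cong (⟦ 5 ⟧ *_) (slantSum-pascal 0 N)) (proj₁ (proj₂ step)) ,
  trans (cong (⟦ 10 ⟧ *_) (slantSum-pascal 1 N)) (proj₂ (proj₂ step))
  where
  ih = slantSum-closed-forms N
  step = slantSum-closed-forms-step (slantSum 0 N) (slantSum 1 N) (slantSum 2 N)
           (pow ⟦ 2 ⟧ N) (cosQuarterTurns N) (sinQuarterTurns N) (proj₁ ih) (proj₁ (proj₂ ih)) (proj₂ (proj₂ ih))

slantSum-identity₁ : ∀ N → slantSum 0 N + ⟦ 3 ⟧ * slantSum 1 (N ∸ 1) ≡ pow ⟦ 2 ⟧ N + cosQuarterTurns (suc N)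
slantSum-identity₁ zero = refl
slantSum-identity₁ (suc N) =
  combine (slantSum 0 (suc N)) (slantSum 1 N) (pow ⟦ 2 ⟧ N) (cosQuarterTurns N) (sinQuarterTurns N)
          (proj₁ (slantSum-closed-forms (suc N))) (proj₁ (proj₂ (slantSum-closed-forms N)))
  where
  combine : ∀ P Q p c s →
    ⟦ 5 ⟧ * P ≡ ⟦ 2 ⟧ * (⟦ 2 ⟧ * p) + ⟦ 3 ⟧ * (- s) + c →
    ⟦ 5 ⟧ * Q ≡ ⟦ 2 ⟧ * p - ⟦ 2 ⟧ * c + s →
    P + ⟦ 3 ⟧ * Q ≡ ⟦ 2 ⟧ * p + - c
  combine P Q p c s hP hQ = begin
    P + ⟦ 3 ⟧ * Q                                   ≡⟨ solve (P ∷ Q ∷ []) ℚ-ring ⟩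
    (1ℚ ÷′ ⟦ 5 ⟧) * (⟦ 5 ⟧ * P + ⟦ 3 ⟧ * (⟦ 5 ⟧ * Q))
                                                    ≡⟨ cong₂ (λ x y → (1ℚ ÷′ ⟦ 5 ⟧) * (x + ⟦ 3 ⟧ * y)) hP hQ ⟩
    (1ℚ ÷′ ⟦ 5 ⟧) * (⟦ 2 ⟧ * (⟦ 2 ⟧ * p) + ⟦ 3 ⟧ * (- s) + c + ⟦ 3 ⟧ * (⟦ 2 ⟧ * p - ⟦ 2 ⟧ * c + s))
                                                    ≡⟨ solve (p ∷ c ∷ s ∷ []) ℚ-ring ⟩
    ⟦ 2 ⟧ * p + - c                                 ∎

slantSum-identity₂ : ∀ N →
  ⟦ 2 ⟧ * slantSum 1 N + ⟦ 3 ⟧ * slantSum 0 N ≡ ⟦ 2 ⟧ * pow ⟦ 2 ⟧ N + cosQuarterTurns N + sinQuarterTurns N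
slantSum-identity₂ N =
  combine (slantSum 0 N) (slantSum 1 N) (pow ⟦ 2 ⟧ N) (cosQuarterTurns N) (sinQuarterTurns N)
          (proj₁ (slantSum-closed-forms N)) (proj₁ (proj₂ (slantSum-closed-forms N)))
  where
  combine : ∀ P Q p c s →
    ⟦ 5 ⟧ * P ≡ ⟦ 2 ⟧ * p + ⟦ 3 ⟧ * c + s →
    ⟦ 5 ⟧ * Q ≡ ⟦ 2 ⟧ * p - ⟦ 2 ⟧ * c + s →
    ⟦ 2 ⟧ * Q + ⟦ 3 ⟧ * P ≡ ⟦ 2 ⟧ * p + c + s
  combine P Q p c s hP hQ = begin
    ⟦ 2 ⟧ * Q + ⟦ 3 ⟧ * P                                     ≡⟨ solve (P ∷ Q ∷ []) ℚ-ring ⟩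
    (1ℚ ÷′ ⟦ 5 ⟧) * (⟦ 2 ⟧ * (⟦ 5 ⟧ * Q) + ⟦ 3 ⟧ * (⟦ 5 ⟧ * P))
                                                              ≡⟨ cong₂ (λ x y → (1ℚ ÷′ ⟦ 5 ⟧) * (⟦ 2 ⟧ * x + ⟦ 3 ⟧ * y)) hQ hP ⟩
    (1ℚ ÷′ ⟦ 5 ⟧) * (⟦ 2 ⟧ * (⟦ 2 ⟧ * p - ⟦ 2 ⟧ * c + s) + ⟦ 3 ⟧ * (⟦ 2 ⟧ * p + ⟦ 3 ⟧ * c + s))
                                                              ≡⟨ solve (p ∷ c ∷ s ∷ []) ℚ-ring ⟩
    ⟦ 2 ⟧ * p + c + s                                         ∎

firstSummand : ℕ → ℕ → ℚ
firstSummand n i = (1ℚ ÷′ (⟦ n ⟧ - ⟦ 3 ⟧ * ⟦ i ⟧)) * ⟦ (n ∸ i ∸ 1) C (2 ℕ.* i) ⟧ * pow ⟦ 2 ⟧ i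

secondSummand : ℕ → ℕ → ℚ
secondSummand n i = (1ℚ ÷′ (⟦ n ⟧ - ⟦ 3 ⟧ * ⟦ i ⟧)) * ⟦ (n ∸ i) C (2 ℕ.* i ℕ.+ 1) ⟧ * pow ⟦ 2 ⟧ i

slantTerm-absorption₁ : ∀ {N j D} → suc N ≡ 3 ℕ.* suc j ℕ.+ D →
  suc N ℕ.* slantTerm 0 N (suc j) ≡ D ℕ.* (slantTerm 0 N (suc j) ℕ.+ 3 ℕ.* slantTerm 1 (N ∸ 1) j)
slantTerm-absorption₁ {N} {j} {D} n≡3[1+j]+D = begin
  suc N ℕ.* slantTerm 0 N (suc j)
    ≡⟨ cong₂ ℕ._*_ n≡3[1+j]+D (slantTerm-suc 0 N j) ⟩
  (3 ℕ.* suc j ℕ.+ D) ℕ.* (2 ℕ.* (X ℕ.* t))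
    ≡⟨ rearrange j D X Y t absorption ⟩
  D ℕ.* (2 ℕ.* (X ℕ.* t) ℕ.+ 3 ℕ.* (Y ℕ.* t))
    ≡⟨ cong (λ z → D ℕ.* (z ℕ.+ 3 ℕ.* (Y ℕ.* t))) (sym (slantTerm-suc 0 N j)) ⟩
  D ℕ.* (slantTerm 0 N (suc j) ℕ.+ 3 ℕ.* slantTerm 1 (N ∸ 1) j) ∎
  where
  K = N ∸ 1 ∸ j
  X = K C (2 ℕ.+ 2 ℕ.* j)
  Y = K C (1 ℕ.+ 2 ℕ.* j)
  t = 2 ℕ.^ j
  K≡1+2j+D : K ≡ suc (2 ℕ.* j) ℕ.+ D
  K≡1+2j+D = begin
    N ∸ 1 ∸ j                              ≡⟨ ℕP.∸-+-assoc N 1 j ⟩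
    N ∸ suc j                              ≡⟨ cong (_∸ suc j) (ℕP.suc-injective (trans n≡3[1+j]+D (split j D))) ⟩
    suc j ℕ.+ (suc (2 ℕ.* j) ℕ.+ D) ∸ suc j ≡⟨ ℕP.m+n∸m≡n (suc j) _ ⟩
    suc (2 ℕ.* j) ℕ.+ D                    ∎
    where
    split : ∀ j D → 3 ℕ.* suc j ℕ.+ D ≡ suc (suc j ℕ.+ (suc (2 ℕ.* j) ℕ.+ D))
    split = ℕ-Ring.solve-∀
  absorption : (2 ℕ.+ 2 ℕ.* j) ℕ.* X ≡ D ℕ.* Y
  absorption = subst (λ k → (2 ℕ.+ 2 ℕ.* j) ℕ.* (k C (2 ℕ.+ 2 ℕ.* j)) ≡ D ℕ.* (k C (1 ℕ.+ 2 ℕ.* j)))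
                     (sym K≡1+2j+D) ([1+k]*[k+d]C[1+k]≡d*[k+d]Ck (suc (2 ℕ.* j)) D)
  rearrange : ∀ j D X Y t → (2 ℕ.+ 2 ℕ.* j) ℕ.* X ≡ D ℕ.* Y →
    (3 ℕ.* suc j ℕ.+ D) ℕ.* (2 ℕ.* (X ℕ.* t)) ≡ D ℕ.* (2 ℕ.* (X ℕ.* t) ℕ.+ 3 ℕ.* (Y ℕ.* t))
  rearrange j D X Y t hyp = begin
    (3 ℕ.* suc j ℕ.+ D) ℕ.* (2 ℕ.* (X ℕ.* t))              ≡⟨ ℕ-Ring.solve (j ∷ D ∷ X ∷ t ∷ []) ⟩
    D ℕ.* (2 ℕ.* (X ℕ.* t)) ℕ.+ 3 ℕ.* ((2 ℕ.+ 2 ℕ.* j) ℕ.* X) ℕ.* t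
                                                           ≡⟨ cong (λ z → D ℕ.* (2 ℕ.* (X ℕ.* t)) ℕ.+ 3 ℕ.* z ℕ.* t) hyp ⟩
    D ℕ.* (2 ℕ.* (X ℕ.* t)) ℕ.+ 3 ℕ.* (D ℕ.* Y) ℕ.* t      ≡⟨ ℕ-Ring.solve (D ∷ X ∷ Y ∷ t ∷ []) ⟩
    D ℕ.* (2 ℕ.* (X ℕ.* t) ℕ.+ 3 ℕ.* (Y ℕ.* t))            ∎

slantTerm-absorption₂ : ∀ {n i D} → n ≡ 3 ℕ.* i ℕ.+ D →
  (2 ℕ.* n ℕ.+ 3) ℕ.* slantTerm 1 n i ≡ D ℕ.* (2 ℕ.* slantTerm 1 n i ℕ.+ 3 ℕ.* slantTerm 0 n i)
slantTerm-absorption₂ {n} {i} {D} n≡3i+D = begin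
  (2 ℕ.* n ℕ.+ 3) ℕ.* (X ℕ.* t)          ≡⟨ cong (λ m → (2 ℕ.* m ℕ.+ 3) ℕ.* (X ℕ.* t)) n≡3i+D ⟩
  (2 ℕ.* (3 ℕ.* i ℕ.+ D) ℕ.+ 3) ℕ.* (X ℕ.* t) ≡⟨ rearrange i D X Y t absorption ⟩
  D ℕ.* (2 ℕ.* (X ℕ.* t) ℕ.+ 3 ℕ.* (Y ℕ.* t)) ∎
  where
  K = n ∸ i
  X = K C (1 ℕ.+ 2 ℕ.* i)
  Y = K C (2 ℕ.* i)
  t = 2 ℕ.^ i
  K≡2i+D : K ≡ 2 ℕ.* i ℕ.+ D
  K≡2i+D = trans (cong (_∸ i) (trans n≡3i+D (split i D))) (ℕP.m+n∸m≡n i _)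
    where
    split : ∀ i D → 3 ℕ.* i ℕ.+ D ≡ i ℕ.+ (2 ℕ.* i ℕ.+ D)
    split = ℕ-Ring.solve-∀
  absorption : (1 ℕ.+ 2 ℕ.* i) ℕ.* X ≡ D ℕ.* Y
  absorption = subst (λ k → (1 ℕ.+ 2 ℕ.* i) ℕ.* (k C (1 ℕ.+ 2 ℕ.* i)) ≡ D ℕ.* (k C (2 ℕ.* i)))
                     (sym K≡2i+D) ([1+k]*[k+d]C[1+k]≡d*[k+d]Ck (2 ℕ.* i) D)
  rearrange : ∀ i D X Y t → (1 ℕ.+ 2 ℕ.* i) ℕ.* X ≡ D ℕ.* Y →
    (2 ℕ.* (3 ℕ.* i ℕ.+ D) ℕ.+ 3) ℕ.* (X ℕ.* t) ≡ D ℕ.* (2 ℕ.* (X ℕ.* t) ℕ.+ 3 ℕ.* (Y ℕ.* t))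
  rearrange i D X Y t hyp = begin
    (2 ℕ.* (3 ℕ.* i ℕ.+ D) ℕ.+ 3) ℕ.* (X ℕ.* t)        ≡⟨ ℕ-Ring.solve (i ∷ D ∷ X ∷ t ∷ []) ⟩
    D ℕ.* (2 ℕ.* (X ℕ.* t)) ℕ.+ 3 ℕ.* ((1 ℕ.+ 2 ℕ.* i) ℕ.* X) ℕ.* t
                                                       ≡⟨ cong (λ z → D ℕ.* (2 ℕ.* (X ℕ.* t)) ℕ.+ 3 ℕ.* z ℕ.* t) hyp ⟩
    D ℕ.* (2 ℕ.* (X ℕ.* t)) ℕ.+ 3 ℕ.* (D ℕ.* Y) ℕ.* t  ≡⟨ ℕ-Ring.solve (D ∷ X ∷ Y ∷ t ∷ []) ⟩
    D ℕ.* (2 ℕ.* (X ℕ.* t) ℕ.+ 3 ℕ.* (Y ℕ.* t))        ∎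

reciprocal-summand : ∀ n i A x y → 3 ℕ.* i < n → 0 < A → A ℕ.* x ≡ (n ∸ 3 ℕ.* i) ℕ.* y →
  (1ℚ ÷′ (⟦ n ⟧ - ⟦ 3 ⟧ * ⟦ i ⟧)) * ⟦ x ⟧ ≡ (1ℚ ÷′ ⟦ A ⟧) * ⟦ y ⟧
reciprocal-summand n i A x y 3i<n 0<A Ax≡Dy = begin
  (1ℚ ÷′ (⟦ n ⟧ - ⟦ 3 ⟧ * ⟦ i ⟧)) * ⟦ x ⟧  ≡⟨ cong (λ d → (1ℚ ÷′ d) * ⟦ x ⟧) n-3i≡D ⟩
  (1ℚ ÷′ ⟦ D ⟧) * ⟦ x ⟧
    ≡⟨ ÷′-cross {⟦ A ⟧} {⟦ D ⟧} {⟦ x ⟧} {⟦ y ⟧} (⟦⟧≢0 0<A) (⟦⟧≢0 (ℕP.m<n⇒0<n∸m 3i<n))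
                (trans (sym (⟦⟧-homo-* A x)) (trans (cong ⟦_⟧ Ax≡Dy) (⟦⟧-homo-* D y))) ⟩
  (1ℚ ÷′ ⟦ A ⟧) * ⟦ y ⟧                   ∎
  where
  D = n ∸ 3 ℕ.* i
  n-3i≡D : ⟦ n ⟧ - ⟦ 3 ⟧ * ⟦ i ⟧ ≡ ⟦ D ⟧
  n-3i≡D = sym (trans (⟦⟧-homo-∸ (ℕP.<⇒≤ 3i<n)) (cong (λ t → ⟦ n ⟧ - t) (⟦⟧-homo-* 3 i)))

coefficient-times-power : ∀ a b i → a * ⟦ b ⟧ * pow ⟦ 2 ⟧ i ≡ a * ⟦ b ℕ.* 2 ℕ.^ i ⟧
coefficient-times-power a b i = begin
  a * ⟦ b ⟧ * pow ⟦ 2 ⟧ i       ≡⟨ ℚP.*-assoc a ⟦ b ⟧ (pow ⟦ 2 ⟧ i) ⟩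
  a * (⟦ b ⟧ * pow ⟦ 2 ⟧ i)     ≡⟨ cong (λ z → a * (⟦ b ⟧ * z)) (⟦⟧-homo-^ 2 i) ⟩
  a * (⟦ b ⟧ * ⟦ 2 ℕ.^ i ⟧)     ≡⟨ cong (a *_) (sym (⟦⟧-homo-* b (2 ℕ.^ i))) ⟩
  a * ⟦ b ℕ.* 2 ℕ.^ i ⟧         ∎

firstSummand-zero : ∀ N → firstSummand (suc N) 0 ≡ (1ℚ ÷′ ⟦ suc N ⟧) * ⟦ slantTerm 0 N 0 ⟧
firstSummand-zero N =
  trans (coefficient-times-power (1ℚ ÷′ (⟦ suc N ⟧ - ⟦ 3 ⟧ * ⟦ 0 ⟧)) (N C 0) 0)
        (reciprocal-summand (suc N) 0 (suc N) (slantTerm 0 N 0) (slantTerm 0 N 0) (s≤s z≤n) (s≤s z≤n) refl)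

firstSummand-suc : ∀ {N j} → 3 ℕ.* suc j < suc N →
  firstSummand (suc N) (suc j) ≡ (1ℚ ÷′ ⟦ suc N ⟧) * (⟦ slantTerm 0 N (suc j) ⟧ + ⟦ 3 ⟧ * ⟦ slantTerm 1 (N ∸ 1) j ⟧)
firstSummand-suc {N} {j} 3[1+j]<n = begin
  firstSummand (suc N) (suc j)
    ≡⟨ cong (λ m → c′ * ⟦ m C (2 ℕ.* suc j) ⟧ * pow ⟦ 2 ⟧ (suc j)) top ⟩
  c′ * ⟦ (N ∸ suc j) C (2 ℕ.* suc j) ⟧ * pow ⟦ 2 ⟧ (suc j)
    ≡⟨ coefficient-times-power c′ ((N ∸ suc j) C (2 ℕ.* suc j)) (suc j) ⟩
  c′ * ⟦ a ⟧
    ≡⟨ reciprocal-summand (suc N) (suc j) (suc N) a (a ℕ.+ 3 ℕ.* b) 3[1+j]<n (s≤s z≤n)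
                          (slantTerm-absorption₁ {N} {j} {suc N ∸ 3 ℕ.* suc j} (sym (ℕP.m+[n∸m]≡n (ℕP.<⇒≤ 3[1+j]<n)))) ⟩
  c * ⟦ a ℕ.+ 3 ℕ.* b ⟧
    ≡⟨ cong (c *_) (trans (⟦⟧-homo-+ a (3 ℕ.* b)) (cong (λ s → ⟦ a ⟧ + s) (⟦⟧-homo-* 3 b))) ⟩
  c * (⟦ a ⟧ + ⟦ 3 ⟧ * ⟦ b ⟧) ∎
  where
  c′ = 1ℚ ÷′ (⟦ suc N ⟧ - ⟦ 3 ⟧ * ⟦ suc j ⟧)
  c = 1ℚ ÷′ ⟦ suc N ⟧
  a = slantTerm 0 N (suc j)
  b = slantTerm 1 (N ∸ 1) j
  top : suc N ∸ suc j ∸ 1 ≡ N ∸ suc j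
  top = trans (ℕP.∸-+-assoc (suc N) (suc j) 1) (cong (suc N ∸_) (ℕP.+-comm (suc j) 1))

0<2n+3 : ∀ n → 0 < 2 ℕ.* n ℕ.+ 3
0<2n+3 n = ℕP.<-≤-trans (s≤s z≤n) (ℕP.m≤n+m 3 (2 ℕ.* n))

secondSummand-slant : ∀ {n i} → 3 ℕ.* i < n →
  secondSummand n i ≡ (1ℚ ÷′ ⟦ 2 ℕ.* n ℕ.+ 3 ⟧) * (⟦ 2 ⟧ * ⟦ slantTerm 1 n i ⟧ + ⟦ 3 ⟧ * ⟦ slantTerm 0 n i ⟧)
secondSummand-slant {n} {i} 3i<n = begin
  secondSummand n i
    ≡⟨ cong (λ k → c′ * ⟦ (n ∸ i) C k ⟧ * pow ⟦ 2 ⟧ i) (ℕP.+-comm (2 ℕ.* i) 1) ⟩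
  c′ * ⟦ (n ∸ i) C (1 ℕ.+ 2 ℕ.* i) ⟧ * pow ⟦ 2 ⟧ i
    ≡⟨ coefficient-times-power c′ ((n ∸ i) C (1 ℕ.+ 2 ℕ.* i)) i ⟩
  c′ * ⟦ a ⟧
    ≡⟨ reciprocal-summand n i (2 ℕ.* n ℕ.+ 3) a (2 ℕ.* a ℕ.+ 3 ℕ.* b) 3i<n (0<2n+3 n)
                          (slantTerm-absorption₂ {n} {i} {n ∸ 3 ℕ.* i} (sym (ℕP.m+[n∸m]≡n (ℕP.<⇒≤ 3i<n)))) ⟩
  c * ⟦ 2 ℕ.* a ℕ.+ 3 ℕ.* b ⟧
    ≡⟨ cong (c *_) (trans (⟦⟧-homo-+ (2 ℕ.* a) (3 ℕ.* b)) (cong₂ _+_ (⟦⟧-homo-* 2 a) (⟦⟧-homo-* 3 b))) ⟩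
  c * (⟦ 2 ⟧ * ⟦ a ⟧ + ⟦ 3 ⟧ * ⟦ b ⟧) ∎
  where
  c′ = 1ℚ ÷′ (⟦ n ⟧ - ⟦ 3 ⟧ * ⟦ i ⟧)
  c = 1ℚ ÷′ ⟦ 2 ℕ.* n ℕ.+ 3 ⟧
  a = slantTerm 1 n i
  b = slantTerm 0 n i

𝟙-cong : ∀ {p q} {P : Set p} {Q : Set q} → (P → Q) → (Q → P) → (d : Dec P) (e : Dec Q) → 𝟙 d ≡ 𝟙 e
𝟙-cong _ _ (yes _) (yes _) = refl
𝟙-cong _ _ (no _) (no _) = refl
𝟙-cong P→Q Q→P (yes p) (no ¬q) = contradiction (P→Q p) ¬q
𝟙-cong P→Q Q→P (no ¬p) (yes q) = contradiction (Q→P q) ¬p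

𝟙*-cong : ∀ {p} {P : Set p} (d : Dec P) {x y : ℚ} → (P → x ≡ y) → 𝟙 d * x ≡ 𝟙 d * y
𝟙*-cong (yes p) x≡y = cong (1ℚ *_) (x≡y p)
𝟙*-cong (no _) {x} {y} _ = trans (ℚP.*-zeroˡ x) (sym (ℚP.*-zeroˡ y))

cosQuarterTurns-parity : ∀ n → cosQuarterTurns n ≡ 𝟙 (2 ∣? n) * pow (- 1ℚ) (n ℕ./ 2)
cosQuarterTurns-parity zero = refl
cosQuarterTurns-parity (suc zero) = refl
cosQuarterTurns-parity (suc (suc m)) = begin
  - cosQuarterTurns m                          ≡⟨ cong -_ (cosQuarterTurns-parity m) ⟩
  - (𝟙 (2 ∣? m) * pow (- 1ℚ) (m ℕ./ 2))         ≡⟨ -[xy]≡x[-y] (𝟙 (2 ∣? m)) (pow (- 1ℚ) (m ℕ./ 2)) ⟩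
  𝟙 (2 ∣? m) * pow (- 1ℚ) (suc (m ℕ./ 2))
    ≡⟨ cong₂ (λ u k → u * pow (- 1ℚ) k) (𝟙-cong 2∣m⇒2∣2+m 2∣2+m⇒2∣m (2 ∣? m) (2 ∣? (2 ℕ.+ m)))
                                        (sym (m/n≡1+[m∸n]/n {2 ℕ.+ m} {2} (s≤s (s≤s z≤n)))) ⟩
  𝟙 (2 ∣? (2 ℕ.+ m)) * pow (- 1ℚ) ((2 ℕ.+ m) ℕ./ 2) ∎
  where
  -[xy]≡x[-y] : ∀ x y → - (x * y) ≡ x * (- 1ℚ * y)
  -[xy]≡x[-y] x y = solve (x ∷ y ∷ []) ℚ-ring
  2∣m⇒2∣2+m : 2 ∣ m → 2 ∣ 2 ℕ.+ m
  2∣m⇒2∣2+m = ∣m∣n⇒∣m+n ∣-refl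
  2∣2+m⇒2∣m : 2 ∣ 2 ℕ.+ m → 2 ∣ m
  2∣2+m⇒2∣m 2∣2+m = ∣m+n∣m⇒∣n 2∣2+m ∣-refl

-- The slant term that the summation range leaves out, at i = n/3 where n − 3i = 0 (halved for the
-- second sum); it vanishes unless 3 ∣ n.
excludedTerm : ℕ → ℚ
excludedTerm n = 𝟙 (3 ∣? n) * pow ⟦ 2 ⟧ (n ℕ./ 3 ∸ 1)

slantTerm-edge : ∀ {p} {P : Set p} (d : Dec P) r {M} j → (P → M ≡ r ℕ.+ 3 ℕ.* j) → (¬ P → M < r ℕ.+ 3 ℕ.* j) →
  ⟦ slantTerm r M j ⟧ ≡ 𝟙 d * ⟦ 2 ℕ.^ j ⟧
slantTerm-edge (yes p) r j diagonal _ =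
  trans (cong ⟦_⟧ (trans (cong (λ m → slantTerm r m j) (diagonal p)) (slantTerm-diagonal r j)))
        (sym (ℚP.*-identityˡ ⟦ 2 ℕ.^ j ⟧))
slantTerm-edge (no ¬p) r j _ below =
  trans (cong ⟦_⟧ (slantTerm-vanishes r j (below ¬p))) (sym (ℚP.*-zeroˡ ⟦ 2 ℕ.^ j ⟧))

module _ {n L : ℕ} (3L<n : 3 ℕ.* L < n) (n≤3[1+L] : n ≤ 3 ℕ.* suc L) where

  3∣n⇒n≡3[1+L] : 3 ∣ n → n ≡ 3 ℕ.* suc L
  3∣n⇒n≡3[1+L] (divides-refl k) = trans (ℕP.*-comm k 3) (cong (3 ℕ.*_) (ℕP.≤-antisym k≤1+L 1+L≤k))
    where
    k≤1+L : k ≤ suc L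
    k≤1+L = ℕP.*-cancelˡ-≤ 3 (subst (ℕ._≤ 3 ℕ.* suc L) (ℕP.*-comm k 3) n≤3[1+L])
    1+L≤k : suc L ≤ k
    1+L≤k = ℕP.*-cancelˡ-< 3 L k (subst (3 ℕ.* L <_) (ℕP.*-comm k 3) 3L<n)

  3∤n⇒n<3[1+L] : ¬ 3 ∣ n → n < 3 ℕ.* suc L
  3∤n⇒n<3[1+L] 3∤n = ℕP.≤∧≢⇒< n≤3[1+L] (λ n≡ → 3∤n (subst (3 ∣_) (sym n≡) (m∣m*n (suc L))))

  pow-at-third : 3 ∣ n → ⟦ 2 ℕ.^ L ⟧ ≡ pow ⟦ 2 ⟧ (n ℕ./ 3 ∸ 1)
  pow-at-third 3∣n = trans (sym (⟦⟧-homo-^ 2 L)) (cong (λ k → pow ⟦ 2 ⟧ (k ∸ 1)) (sym n/3≡1+L))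
    where
    n/3≡1+L : n ℕ./ 3 ≡ suc L
    n/3≡1+L = trans (cong (ℕ._/ 3) (trans (3∣n⇒n≡3[1+L] 3∣n) (ℕP.*-comm 3 (suc L)))) (m*n/n≡m (suc L) 3)

  excludedTerm-first : ⟦ slantTerm 1 (n ∸ 2) L ⟧ ≡ excludedTerm n
  excludedTerm-first =
    trans (slantTerm-edge (3 ∣? n) 1 L diagonal below) (𝟙*-cong (3 ∣? n) pow-at-third)
    where
    diagonal : 3 ∣ n → n ∸ 2 ≡ 1 ℕ.+ 3 ℕ.* L
    diagonal 3∣n = cong (_∸ 2) (trans (3∣n⇒n≡3[1+L] 3∣n) (ℕP.*-suc 3 L))
    below : ¬ 3 ∣ n → n ∸ 2 < 1 ℕ.+ 3 ℕ.* L
    below 3∤n = s≤s (ℕP.∸-monoˡ-≤ 2 (ℕ.s≤s⁻¹ (subst (n <_) (ℕP.*-suc 3 L) (3∤n⇒n<3[1+L] 3∤n))))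

  excludedTerm-second : ⟦ slantTerm 0 n (suc L) ⟧ ≡ ⟦ 2 ⟧ * excludedTerm n
  excludedTerm-second = begin
    ⟦ slantTerm 0 n (suc L) ⟧
      ≡⟨ slantTerm-edge (3 ∣? n) 0 (suc L) 3∣n⇒n≡3[1+L] 3∤n⇒n<3[1+L] ⟩
    𝟙 (3 ∣? n) * ⟦ 2 ℕ.* 2 ℕ.^ L ⟧
      ≡⟨ 𝟙*-cong (3 ∣? n) (λ 3∣n → trans (⟦⟧-homo-* 2 (2 ℕ.^ L)) (cong (⟦ 2 ⟧ *_) (pow-at-third 3∣n))) ⟩
    𝟙 (3 ∣? n) * (⟦ 2 ⟧ * pow ⟦ 2 ⟧ (n ℕ./ 3 ∸ 1))
      ≡⟨ x[yz]≡y[xz] (𝟙 (3 ∣? n)) ⟦ 2 ⟧ (pow ⟦ 2 ⟧ (n ℕ./ 3 ∸ 1)) ⟩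
    ⟦ 2 ⟧ * excludedTerm n
      ∎
    where
    x[yz]≡y[xz] : ∀ x y z → x * (y * z) ≡ y * (x * z)
    x[yz]≡y[xz] x y z = solve (x ∷ y ∷ z ∷ []) ℚ-ring

firstSum-slant : ∀ N L → 3 ℕ.* L < suc N →
  sumFirst (suc L) (firstSummand (suc N))
    ≡ (1ℚ ÷′ ⟦ suc N ⟧) * (sumFirst (suc L) (λ i → ⟦ slantTerm 0 N i ⟧)
                           + ⟦ 3 ⟧ * sumFirst L (λ j → ⟦ slantTerm 1 (N ∸ 1) j ⟧))
firstSum-slant N L 3L<n = begin
  sumFirst (suc L) (firstSummand (suc N))
    ≡⟨ sumFirst-suc L (firstSummand (suc N)) ⟩
  firstSummand (suc N) 0 + sumFirst L (λ j → firstSummand (suc N) (suc j))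
    ≡⟨ cong₂ _+_ (firstSummand-zero N) (sumFirst-cong L (λ j j<L → firstSummand-suc {N} {j} (3[1+j]<n j<L))) ⟩
  c * a 0 + sumFirst L (λ j → c * (a (suc j) + ⟦ 3 ⟧ * b j))
    ≡⟨ cong (λ s → c * a 0 + s) (trans (sumFirst-*ˡ L c (λ j → a (suc j) + ⟦ 3 ⟧ * b j))
                                 (cong (c *_) (trans (sumFirst-+ L (λ j → a (suc j)) (λ j → ⟦ 3 ⟧ * b j))
                                 (cong (λ s → sumFirst L (λ j → a (suc j)) + s) (sumFirst-*ˡ L ⟦ 3 ⟧ b))))) ⟩
  c * a 0 + c * (sumFirst L (λ j → a (suc j)) + ⟦ 3 ⟧ * sumFirst L b)
    ≡⟨ regroup c (a 0) (sumFirst L (λ j → a (suc j))) (⟦ 3 ⟧ * sumFirst L b) ⟩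
  c * ((a 0 + sumFirst L (λ j → a (suc j))) + ⟦ 3 ⟧ * sumFirst L b)
    ≡⟨ cong (λ s → c * (s + ⟦ 3 ⟧ * sumFirst L b)) (sym (sumFirst-suc L a)) ⟩
  c * (sumFirst (suc L) a + ⟦ 3 ⟧ * sumFirst L b) ∎
  where
  c = 1ℚ ÷′ ⟦ suc N ⟧
  a = λ i → ⟦ slantTerm 0 N i ⟧
  b = λ j → ⟦ slantTerm 1 (N ∸ 1) j ⟧
  3[1+j]<n : ∀ {j} → j < L → 3 ℕ.* suc j < suc N
  3[1+j]<n j<L = ℕP.≤-<-trans (ℕP.*-monoʳ-≤ 3 j<L) 3L<n
  regroup : ∀ c x y z → c * x + c * (y + z) ≡ c * ((x + y) + z)
  regroup c x y z = solve (c ∷ x ∷ y ∷ z ∷ []) ℚ-ring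

secondSum-slant : ∀ n L → 3 ℕ.* L < n →
  sumFirst (suc L) (secondSummand n)
    ≡ (1ℚ ÷′ ⟦ 2 ℕ.* n ℕ.+ 3 ⟧) * (⟦ 2 ⟧ * sumFirst (suc L) (λ i → ⟦ slantTerm 1 n i ⟧)
                                  + ⟦ 3 ⟧ * sumFirst (suc L) (λ i → ⟦ slantTerm 0 n i ⟧))
secondSum-slant n L 3L<n = begin
  sumFirst (suc L) (secondSummand n)
    ≡⟨ sumFirst-cong (suc L) (λ i i≤L → secondSummand-slant {n} {i}
                                           (ℕP.≤-<-trans (ℕP.*-monoʳ-≤ 3 (ℕ.s≤s⁻¹ i≤L)) 3L<n)) ⟩
  sumFirst (suc L) (λ i → w * (⟦ 2 ⟧ * a i + ⟦ 3 ⟧ * b i))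
    ≡⟨ sumFirst-*ˡ (suc L) w (λ i → ⟦ 2 ⟧ * a i + ⟦ 3 ⟧ * b i) ⟩
  w * sumFirst (suc L) (λ i → ⟦ 2 ⟧ * a i + ⟦ 3 ⟧ * b i)
    ≡⟨ cong (w *_) (trans (sumFirst-+ (suc L) (λ i → ⟦ 2 ⟧ * a i) (λ i → ⟦ 3 ⟧ * b i))
                          (cong₂ _+_ (sumFirst-*ˡ (suc L) ⟦ 2 ⟧ a) (sumFirst-*ˡ (suc L) ⟦ 3 ⟧ b))) ⟩
  w * (⟦ 2 ⟧ * sumFirst (suc L) a + ⟦ 3 ⟧ * sumFirst (suc L) b) ∎
  where
  w = 1ℚ ÷′ ⟦ 2 ℕ.* n ℕ.+ 3 ⟧
  a = λ i → ⟦ slantTerm 1 n i ⟧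
  b = λ i → ⟦ slantTerm 0 n i ⟧

firstClosedForm : ℕ → ℚ
firstClosedForm n = (1ℚ ÷′ ⟦ n ⟧) * (pow ⟦ 2 ⟧ (n ∸ 1) + 𝟙 (2 ∣? n) * pow (- 1ℚ) (n ℕ./ 2)
                                     - 𝟙 (3 ∣? n) * ⟦ 3 ⟧ * pow ⟦ 2 ⟧ (n ℕ./ 3 ∸ 1))

secondClosedForm : ℕ → ℚ
secondClosedForm n = (1ℚ ÷′ (⟦ n ⟧ + ⟦ 3 ⟧ ÷′ ⟦ 2 ⟧))
  * (pow ⟦ 2 ⟧ n + 𝟙 (2 ∣? n) * (1ℚ ÷′ ⟦ 2 ⟧) * pow (- 1ℚ) (n ℕ./ 2)
     + 𝟙 (2 ∣? (n ∸ 1)) * (1ℚ ÷′ ⟦ 2 ⟧) * pow (- 1ℚ) ((n ∸ 1) ℕ./ 2)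
     - 𝟙 (3 ∣? n) * ⟦ 3 ⟧ * pow ⟦ 2 ⟧ (n ℕ./ 3 ∸ 1))

three-halves : ∀ n → 1ℚ ÷′ (⟦ n ⟧ + ⟦ 3 ⟧ ÷′ ⟦ 2 ⟧) ≡ ⟦ 2 ⟧ * (1ℚ ÷′ ⟦ 2 ℕ.* n ℕ.+ 3 ⟧)
three-halves n = ÷′-unique (⟦ n ⟧ + ⟦ 3 ⟧ ÷′ ⟦ 2 ⟧) (⟦ 2 ⟧ * w) (begin
  (⟦ n ⟧ + ⟦ 3 ⟧ ÷′ ⟦ 2 ⟧) * (⟦ 2 ⟧ * w)  ≡⟨ clear-denominator ⟦ n ⟧ w ⟩
  (⟦ 2 ⟧ * ⟦ n ⟧ + ⟦ 3 ⟧) * w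
    ≡⟨ cong (_* w) (sym (trans (⟦⟧-homo-+ (2 ℕ.* n) 3) (cong (_+ ⟦ 3 ⟧) (⟦⟧-homo-* 2 n)))) ⟩
  ⟦ 2 ℕ.* n ℕ.+ 3 ⟧ * w                  ≡⟨ ℚP.*-comm ⟦ 2 ℕ.* n ℕ.+ 3 ⟧ w ⟩
  w * ⟦ 2 ℕ.* n ℕ.+ 3 ⟧                  ≡⟨ ÷′-inverseˡ ⟦ 2 ℕ.* n ℕ.+ 3 ⟧ (⟦⟧≢0 (0<2n+3 n)) ⟩
  1ℚ                                     ∎)
  where
  w = 1ℚ ÷′ ⟦ 2 ℕ.* n ℕ.+ 3 ⟧
  clear-denominator : ∀ x w → (x + ⟦ 3 ⟧ ÷′ ⟦ 2 ⟧) * (⟦ 2 ⟧ * w) ≡ (⟦ 2 ⟧ * x + ⟦ 3 ⟧) * w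
  clear-denominator x w = solve (x ∷ w ∷ []) ℚ-ring

firstSum≡firstClosedForm : ∀ n L → 3 ℕ.* L < n → n ≤ 3 ℕ.* suc L →
  sumFirst (suc L) (firstSummand n) ≡ firstClosedForm n
firstSum≡firstClosedForm (suc N) L 3L<n n≤3[1+L] = begin
  sumFirst (suc L) (firstSummand (suc N))
    ≡⟨ firstSum-slant N L 3L<n ⟩
  c * (sumFirst (suc L) (λ i → ⟦ slantTerm 0 N i ⟧) + ⟦ 3 ⟧ * sumFirst L b)
    ≡⟨ cong₂ (λ x y → c * (x + ⟦ 3 ⟧ * y)) (slantSum-truncate 0 (suc L) n≤3[1+L])
             (x+y≡z⇒x≡z-y (sumFirst L b) (excludedTerm (suc N))
               (trans (cong (λ t → sumFirst L b + t) (sym (excludedTerm-first 3L<n n≤3[1+L])))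
                      (slantSum-truncate 1 (suc L) N∸1<1+3[1+L]))) ⟩
  c * (slantSum 0 N + ⟦ 3 ⟧ * (slantSum 1 (N ∸ 1) - excludedTerm (suc N)))
    ≡⟨ cong (c *_) (subtract-excluded (slantSum 0 N) (slantSum 1 (N ∸ 1)) (pow ⟦ 2 ⟧ N)
                     (𝟙 (2 ∣? suc N)) (pow (- 1ℚ) (suc N ℕ./ 2)) (𝟙 (3 ∣? suc N)) (pow ⟦ 2 ⟧ (suc N ℕ./ 3 ∸ 1))
                     (trans (slantSum-identity₁ N) (cong (λ t → pow ⟦ 2 ⟧ N + t) (cosQuarterTurns-parity (suc N))))) ⟩
  firstClosedForm (suc N) ∎
  where
  c = 1ℚ ÷′ ⟦ suc N ⟧
  b = λ j → ⟦ slantTerm 1 (N ∸ 1) j ⟧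
  N∸1<1+3[1+L] : N ∸ 1 < 1 ℕ.+ 3 ℕ.* suc L
  N∸1<1+3[1+L] = ℕP.<-≤-trans (ℕP.≤-<-trans (ℕP.m∸n≤m N 1) n≤3[1+L]) (ℕP.n≤1+n _)
  subtract-excluded : ∀ a b p u v d y → a + ⟦ 3 ⟧ * b ≡ p + u * v →
    a + ⟦ 3 ⟧ * (b - d * y) ≡ p + u * v - d * ⟦ 3 ⟧ * y
  subtract-excluded a b p u v d y eq = begin
    a + ⟦ 3 ⟧ * (b - d * y)             ≡⟨ solve (a ∷ b ∷ d ∷ y ∷ []) ℚ-ring ⟩
    (a + ⟦ 3 ⟧ * b) - d * ⟦ 3 ⟧ * y      ≡⟨ cong (λ s → s - d * ⟦ 3 ⟧ * y) eq ⟩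
    p + u * v - d * ⟦ 3 ⟧ * y           ∎

secondSum≡secondClosedForm : ∀ n L → 3 ℕ.* L < n → n ≤ 3 ℕ.* suc L →
  sumFirst (suc L) (secondSummand n) ≡ secondClosedForm n
secondSum≡secondClosedForm (suc N) L 3L<n n≤3[1+L] = begin
  sumFirst (suc L) (secondSummand n)
    ≡⟨ secondSum-slant n L 3L<n ⟩
  w * (⟦ 2 ⟧ * sumFirst (suc L) (λ i → ⟦ slantTerm 1 n i ⟧) + ⟦ 3 ⟧ * sumFirst (suc L) a)
    ≡⟨ cong₂ (λ x y → w * (⟦ 2 ⟧ * x + ⟦ 3 ⟧ * y)) (slantSum-truncate 1 (suc L) (s≤s n≤3[1+L]))
             (x+y≡z⇒x≡z-y (sumFirst (suc L) a) (⟦ 2 ⟧ * excludedTerm n)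
               (trans (cong (λ t → sumFirst (suc L) a + t) (sym (excludedTerm-second 3L<n n≤3[1+L])))
                      (slantSum-truncate 0 (2 ℕ.+ L) n<3[2+L]))) ⟩
  w * (⟦ 2 ⟧ * slantSum 1 n + ⟦ 3 ⟧ * (slantSum 0 n - ⟦ 2 ⟧ * excludedTerm n))
    ≡⟨ subtract-excluded w (slantSum 0 n) (slantSum 1 n) (pow ⟦ 2 ⟧ n)
         (𝟙 (2 ∣? n)) (pow (- 1ℚ) (n ℕ./ 2)) (𝟙 (2 ∣? N)) (pow (- 1ℚ) (N ℕ./ 2)) (𝟙 (3 ∣? n)) (pow ⟦ 2 ⟧ (n ℕ./ 3 ∸ 1))
         (trans (slantSum-identity₂ n)
                (cong₂ (λ x y → ⟦ 2 ⟧ * pow ⟦ 2 ⟧ n + x + y) (cosQuarterTurns-parity n) (cosQuarterTurns-parity N))) ⟩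
  ⟦ 2 ⟧ * w * r
    ≡⟨ cong (_* r) (sym (three-halves n)) ⟩
  secondClosedForm n ∎
  where
  n = suc N
  w = 1ℚ ÷′ ⟦ 2 ℕ.* n ℕ.+ 3 ⟧
  a = λ i → ⟦ slantTerm 0 n i ⟧
  r = pow ⟦ 2 ⟧ n + 𝟙 (2 ∣? n) * (1ℚ ÷′ ⟦ 2 ⟧) * pow (- 1ℚ) (n ℕ./ 2)
      + 𝟙 (2 ∣? N) * (1ℚ ÷′ ⟦ 2 ⟧) * pow (- 1ℚ) (N ℕ./ 2)
      - 𝟙 (3 ∣? n) * ⟦ 3 ⟧ * pow ⟦ 2 ⟧ (n ℕ./ 3 ∸ 1)
  n<3[2+L] : n < 3 ℕ.* (2 ℕ.+ L)
  n<3[2+L] = ℕP.≤-<-trans n≤3[1+L] (ℕP.*-monoʳ-< 3 (ℕP.n<1+n (suc L)))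
  subtract-excluded : ∀ w a b p u v u′ v′ d y → ⟦ 2 ⟧ * b + ⟦ 3 ⟧ * a ≡ ⟦ 2 ⟧ * p + u * v + u′ * v′ →
    w * (⟦ 2 ⟧ * b + ⟦ 3 ⟧ * (a - ⟦ 2 ⟧ * (d * y)))
      ≡ ⟦ 2 ⟧ * w * (p + u * (1ℚ ÷′ ⟦ 2 ⟧) * v + u′ * (1ℚ ÷′ ⟦ 2 ⟧) * v′ - d * ⟦ 3 ⟧ * y)
  subtract-excluded w a b p u v u′ v′ d y eq = begin
    w * (⟦ 2 ⟧ * b + ⟦ 3 ⟧ * (a - ⟦ 2 ⟧ * (d * y)))       ≡⟨ solve (w ∷ a ∷ b ∷ d ∷ y ∷ []) ℚ-ring ⟩
    w * (⟦ 2 ⟧ * b + ⟦ 3 ⟧ * a - ⟦ 6 ⟧ * (d * y))         ≡⟨ cong (λ s → w * (s - ⟦ 6 ⟧ * (d * y))) eq ⟩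
    w * (⟦ 2 ⟧ * p + u * v + u′ * v′ - ⟦ 6 ⟧ * (d * y))   ≡⟨ solve (w ∷ p ∷ u ∷ v ∷ u′ ∷ v′ ∷ d ∷ y ∷ []) ℚ-ring ⟩
    ⟦ 2 ⟧ * w * (p + u * (1ℚ ÷′ ⟦ 2 ⟧) * v + u′ * (1ℚ ÷′ ⟦ 2 ⟧) * v′ - d * ⟦ 3 ⟧ * y) ∎

3p<3p+r≤3[1+p] : ∀ p {r} → 0 < r → r ≤ 3 → 3 ℕ.* p < 3 ℕ.* p ℕ.+ r × 3 ℕ.* p ℕ.+ r ≤ 3 ℕ.* suc p
3p<3p+r≤3[1+p] p 0<r r≤3 =
  ℕP.m<m+n (3 ℕ.* p) 0<r ,
  ℕP.≤-trans (ℕP.+-monoʳ-≤ (3 ℕ.* p) r≤3) (ℕP.≤-reflexive (trans (ℕP.+-comm (3 ℕ.* p) 3) (sym (ℕP.*-suc 3 p))))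

-- The upper limit U of the sums is ⌊(n − 1)/3⌋, the largest i with 3i < n.
summation-range : ∀ p q → q < 3 → 0 < 3 ℕ.* p ℕ.+ q →
  ∃[ L ] (+ p ℤ.+ ((+ q ℤ.- + 1) ℤD./ + 3) ≡ + L) × 3 ℕ.* L < 3 ℕ.* p ℕ.+ q × 3 ℕ.* p ℕ.+ q ≤ 3 ℕ.* suc L
summation-range zero zero _ ()
summation-range (suc p) zero _ _ =
  p , refl , ℕP.<-≤-trans (ℕP.*-monoʳ-< 3 (ℕP.n<1+n p)) (ℕP.m≤m+n _ 0) , ℕP.≤-reflexive (ℕP.+-identityʳ _)
summation-range p 1 _ _ = p , ℤP.+-identityʳ (+ p) , 3p<3p+r≤3[1+p] p (s≤s z≤n) (s≤s z≤n)
summation-range p 2 _ _ = p , ℤP.+-identityʳ (+ p) , 3p<3p+r≤3[1+p] p (s≤s z≤n) (s≤s (s≤s z≤n))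
summation-range p (suc (suc (suc q))) (s≤s (s≤s (s≤s ()))) _

lemma5p4 : (n p q : ℕ) → 0 < n → q < 3 → n ≡ 3 ℕ.* p ℕ.+ q →
    let U = + p ℤ.+ ((+ q ℤ.- + 1) ℤD./ + 3) in
    (sumUpTo U (λ i → (1ℚ ÷′ (⟦ n ⟧ - ⟦ 3 ⟧ * ⟦ i ⟧)) * ⟦ (n ∸ i ∸ 1) C (2 ℕ.* i) ⟧ * pow ⟦ 2 ⟧ i)
      ≡ (1ℚ ÷′ ⟦ n ⟧) * (pow ⟦ 2 ⟧ (n ∸ 1) + 𝟙 (2 ∣? n) * pow (- 1ℚ) (n ℕ./ 2)
                           - 𝟙 (3 ∣? n) * ⟦ 3 ⟧ * pow ⟦ 2 ⟧ (n ℕ./ 3 ∸ 1)))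
    ×
    (sumUpTo U (λ i → (1ℚ ÷′ (⟦ n ⟧ - ⟦ 3 ⟧ * ⟦ i ⟧)) * ⟦ (n ∸ i) C (2 ℕ.* i ℕ.+ 1) ⟧ * pow ⟦ 2 ⟧ i)
      ≡ (1ℚ ÷′ (⟦ n ⟧ + ⟦ 3 ⟧ ÷′ ⟦ 2 ⟧))
          * (pow ⟦ 2 ⟧ n + 𝟙 (2 ∣? n) * (1ℚ ÷′ ⟦ 2 ⟧) * pow (- 1ℚ) (n ℕ./ 2)
             + 𝟙 (2 ∣? (n ∸ 1)) * (1ℚ ÷′ ⟦ 2 ⟧) * pow (- 1ℚ) ((n ∸ 1) ℕ./ 2)
             - 𝟙 (3 ∣? n) * ⟦ 3 ⟧ * pow ⟦ 2 ⟧ (n ℕ./ 3 ∸ 1)))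
lemma5p4 n p q 0<n q<3 n≡3p+q = first , second
  where
  range = summation-range p q q<3 (subst (0 <_) n≡3p+q 0<n)
  L = proj₁ range
  U≡L = proj₁ (proj₂ range)
  3L<n = subst (3 ℕ.* L <_) (sym n≡3p+q) (proj₁ (proj₂ (proj₂ range)))
  n≤3[1+L] = subst (ℕ._≤ 3 ℕ.* suc L) (sym n≡3p+q) (proj₂ (proj₂ (proj₂ range)))
  first = trans (cong (λ U → sumUpTo U (firstSummand n)) U≡L) (firstSum≡firstClosedForm n L 3L<n n≤3[1+L])
  second = trans (cong (λ U → sumUpTo U (secondSummand n)) U≡L) (secondSum≡secondClosedForm n L 3L<n n≤3[1+L])
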